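{- Let $\phi$ be a formula in the language of $\mathbf{FPT}$. The following are equivalent: (i) $\phi$ has the flatness property; (ii) $\phi$ is semantically equivalent to a classical formula (a formula built from $p_i,\neg p_i,\bot$ using $\wedge,\otimes$ only); (iii) $\phi$ has the downward closure property and the union closure property.
   Context: Fix propositional variables $p_i$, $i\in\mathbb{N}$. A valuation is a function $s:\mathbb{N}\to\{0,1\}$ (more generally on $N\subseteq\mathbb N$); a team is a set of valuations. Write $s(\vec i)$ for $\langle s(i_1),\dots,s(i_k)\rangle$. Formulas of the full propositional team logic $\mathbf{FPT}$: $\phi::=p_i\mid\neg p_i\mid\mathrm{NE}\mid\bot\mid p_{i_1}\dots p_{i_k}\perp p_{j_1}\dots p_{j_m}\mid{=}(p_{i_1},\dots,p_{i_k},p_j)\mid p_{i_1}\dots p_{i_k}\subseteq p_{j_1}\dots p_{j_k}\mid\phi\wedge\phi\mid\phi\otimes\phi\mid\phi\circledast\phi\mid\phi\vee\phi$. Semantics: $X\models p_i$ iff $s(i)=1$ for all $s\in X$; $X\models\neg p_i$ iff $s(i)=0$ for all $s\in X$; $X\models\bot$ iff $X=\emptyset$; $X\models\mathrm{NE}$ iff $X\neq\emptyset$; $X\models p_{\vec i}\perp p_{\vec j}$ iff for all $s,s'\in X$ there is $s''\in X$ with $s''(\vec i)=s(\vec i)$ and $s''(\vec j)=s'(\vec j)$; $X\models{=}(p_{\vec i},p_j)$ iff for all $s,s'\in X$, $s(\vec i)=s'(\vec i)$ implies $s(j)=s'(j)$; $X\models p_{\vec i}\subseteq p_{\vec j}$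 iff for all $s\in X$ there is $s'\in X$ with $s(\vec i)=s'(\vec j)$; $X\models\phi\wedge\psi$ iff both; $X\models\phi\otimes\psi$ iff $X=Y\cup Z$ for some $Y,Z\subseteq X$ with $Y\models\phi$, $Z\models\psi$; $X\models\phi\circledast\psi$ iff $X=\emptyset$ or $X=Y\cup Z$ for some nonempty $Y,Z$ with $Y\models\phi$, $Z\models\psi$; $X\models\phi\vee\psi$ iff $X\models\phi$ or $X\models\psi$. $\phi\equiv\psi$ means they are satisfied by the same teams. A formula $\phi$ has the flatness property if for all teams $X$: $X\models\phi\iff\{s\}\models\phi$ for all $s\in X$; the downward closure property if $X\models\phi$ and $Y\subseteq X$ imply $Y\models\phi$; the union closure property if whenever $X\models\phi$ for all $X\in\mathcal{X}$ (for any set $\mathcal X$ of teams) then $\bigcup\mathcal{X}\models\phi$. -}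

module Defs where

open import Level using (Level) renaming (suc to lsuc; zero to lzero)
open import Data.Nat using (ℕ; suc)
open import Data.Bool using (Bool; true; false)
open import Data.Vec using (Vec; map)
open import Data.Product using (Σ; ∃; _×_; _,_)
open import Data.Sum using (_⊎_)
open import Data.Empty using (⊥)
open import Relation.Nullary using (¬_)
open import Relation.Binary.PropositionalEquality using (_≡_)

Valuation : Set
Valuation = ℕ → Bool

Team : Set₁
Team = Valuation → Set

_at_ : ∀ {k} → Valuation → Vec ℕ k → Vec Bool k
s at is = map s is

data Formula : Set where
  var    : ℕ → Formula
  negvar : ℕ → Formula
  NE     : Formula
  falsum : Formula
  indep  : ∀ {k m} → Vec ℕ (suc k) → Vec ℕ (suc m) → Formula
  dep    : ∀ {k} → Vec ℕ (suc k) → ℕ → Formula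
  incl   : ∀ {k} → Vec ℕ (suc k) → Vec ℕ (suc k) → Formula
  _∧ᶠ_   : Formula → Formula → Formula
  _⊗_    : Formula → Formula → Formula
  _⊛_    : Formula → Formula → Formula
  _∨ᶠ_   : Formula → Formula → Formula

Empty : Team → Set
Empty X = ∀ s → ¬ X s

NonEmpty : Team → Set
NonEmpty X = ∃ λ s → X s

_⊆ᵗ_ : Team → Team → Set
Y ⊆ᵗ X = ∀ s → Y s → X s

IsUnion : Team → Team → Team → Set
IsUnion X Y Z = ∀ s → (X s → Y s ⊎ Z s) × (Y s ⊎ Z s → X s)

_⊨_ : Team → Formula → Set₁
X ⊨ var i    = Level.Lift (lsuc lzero) (∀ s → X s → s i ≡ true)
X ⊨ negvar i = Level.Lift (lsuc lzero) (∀ s → X s → s i ≡ false)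
X ⊨ NE       = Level.Lift (lsuc lzero) (NonEmpty X)
X ⊨ falsum   = Level.Lift (lsuc lzero) (Empty X)
X ⊨ indep is js = Level.Lift (lsuc lzero) (
  ∀ s s' → X s → X s' → ∃ λ s'' → X s'' × (s'' at is ≡ s at is) × (s'' at js ≡ s' at js))
X ⊨ dep is j = Level.Lift (lsuc lzero) (
  ∀ s s' → X s → X s' → s at is ≡ s' at is → s j ≡ s' j)
X ⊨ incl is js = Level.Lift (lsuc lzero) (
  ∀ s → X s → ∃ λ s' → X s' × (s at is ≡ s' at js))
X ⊨ (φ ∧ᶠ ψ) = (X ⊨ φ) × (X ⊨ ψ)
X ⊨ (φ ⊗ ψ) =
  Σ Team λ Y → Σ Team λ Z → IsUnion X Y Z × (Y ⊨ φ) × (Z ⊨ ψ)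
X ⊨ (φ ⊛ ψ) =
  Level.Lift (lsuc lzero) (Empty X) ⊎
  (Σ Team λ Y → Σ Team λ Z → IsUnion X Y Z × Level.Lift (lsuc lzero) (NonEmpty Y) × Level.Lift (lsuc lzero) (NonEmpty Z)
     × (Y ⊨ φ) × (Z ⊨ ψ))
X ⊨ (φ ∨ᶠ ψ) = (X ⊨ φ) ⊎ (X ⊨ ψ)

⟦_⟧ : Valuation → Team
⟦ s ⟧ t = t ≡ s

⋃ : {I : Set} → (I → Team) → Team
⋃ {I} F s = Σ I λ i → F i s

Flat : Formula → Set₁
Flat φ = ∀ (X : Team) → ((X ⊨ φ) → (∀ s → X s → ⟦ s ⟧ ⊨ φ))
                      × ((∀ s → X s → ⟦ s ⟧ ⊨ φ) → X ⊨ φ)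

DownwardClosed : Formula → Set₁
DownwardClosed φ = ∀ (X Y : Team) → X ⊨ φ → Y ⊆ᵗ X → Y ⊨ φ

UnionClosed : Formula → Set₁
UnionClosed φ = ∀ (I : Set) (F : I → Team) → (∀ i → F i ⊨ φ) → ⋃ F ⊨ φ

data Classical : Formula → Set where
  c-var    : ∀ i → Classical (var i)
  c-negvar : ∀ i → Classical (negvar i)
  c-falsum : Classical falsum
  c-∧      : ∀ {φ ψ} → Classical φ → Classical ψ → Classical (φ ∧ᶠ ψ)
  c-⊗      : ∀ {φ ψ} → Classical φ → Classical ψ → Classical (φ ⊗ ψ)

_≡ˢ_ : Formula → Formula → Set₁
φ ≡ˢ ψ = ∀ (X : Team) → ((X ⊨ φ) → (X ⊨ ψ)) × ((X ⊨ ψ) → (X ⊨ φ))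

EquivClassical : Formula → Set₁
EquivClassical φ = Σ Formula λ ψ → Classical ψ × (φ ≡ˢ ψ)

_⟺_ : Set₁ → Set₁ → Set₁
P ⟺ Q = (P → Q) × (Q → P)

-- A flat formula is determined by the valuations s with {s} ⊨ φ. Satisfaction
-- depends only on the finitely many variables of φ, so this set of valuations is
-- described by a decision tree over those variables, and such a tree is a
-- classical formula (⊗ of the two branches p_i ∧ … and ¬p_i ∧ …). Classical
-- formulas are flat, and two flat formulas that agree on singletons are
-- equivalent. Flatness is downward plus union closure because every team is the
-- union of its singletons.
module Submission where

open import Defs
open import Level using (lift; lower; suc; zero)
open import Data.Nat using (ℕ; _≟_)
open import Data.Bool using (Bool; true; false)
open import Data.Vec using (Vec; []; _∷_; toList)
open import Data.List using (List; []; _∷_; _++_)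
open import Data.List.Membership.Propositional using (_∈_)
open import Data.List.Membership.Propositional.Properties using (∈-++⁺ˡ; ∈-++⁺ʳ)
open import Data.List.Relation.Unary.Any using (here; there)
open import Data.Product using (Σ; ∃; _×_; _,_; proj₁; proj₂; swap)
open import Data.Sum using (_⊎_; inj₁; inj₂; [_,_]) renaming (map to ⊎-map)
open import Data.Empty using (⊥; ⊥-elim)
open import Function using (_∘_)
open import Relation.Nullary using (yes; no)
open import Relation.Nullary.Decidable using (True; toWitness; fromWitness)
open import Relation.Binary.PropositionalEquality using (_≡_; refl; sym; trans; cong₂)
open import Axiom.ExcludedMiddle using (ExcludedMiddle)

private variable
  s t : Valuation
  vs ws : List ℕ
  X X' Y Z : Team
  φ ψ : Formula

vars : Formula → List ℕ
vars (var i)       = i ∷ []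
vars (negvar i)    = i ∷ []
vars NE            = []
vars falsum        = []
vars (indep is js) = toList is ++ toList js
vars (dep is j)    = toList is ++ j ∷ []
vars (incl is js)  = toList is ++ toList js
vars (φ ∧ᶠ ψ)      = vars φ ++ vars ψ
vars (φ ⊗ ψ)       = vars φ ++ vars ψ
vars (φ ⊛ ψ)       = vars φ ++ vars ψ
vars (φ ∨ᶠ ψ)      = vars φ ++ vars ψ

_∼[_]_ : Valuation → List ℕ → Valuation → Set
s ∼[ vs ] t = ∀ i → i ∈ vs → s i ≡ t i

∼-++ˡ : ∀ vs → s ∼[ vs ++ ws ] t → s ∼[ vs ] t
∼-++ˡ vs a i i∈ = a i (∈-++⁺ˡ i∈)

∼-++ʳ : ∀ vs → s ∼[ vs ++ ws ] t → s ∼[ ws ] t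
∼-++ʳ vs a i i∈ = a i (∈-++⁺ʳ vs i∈)

∼⇒at≡ : ∀ {k} (is : Vec ℕ k) → s ∼[ toList is ] t → s at is ≡ t at is
∼⇒at≡ []       a = refl
∼⇒at≡ (i ∷ is) a = cong₂ _∷_ (a i (here refl)) (∼⇒at≡ is (λ j j∈ → a j (there j∈)))

-- X ≈[ vs ] X' is the paper's X↾vs = X'↾vs.
_≈[_]_ : Team → List ℕ → Team → Set
X ≈[ vs ] X' = (∀ s → X s → ∃ λ t → X' t × s ∼[ vs ] t)
             × (∀ t → X' t → ∃ λ s → X s × s ∼[ vs ] t)

≈-mono : (∀ {s t} → s ∼[ vs ] t → s ∼[ ws ] t) → X ≈[ vs ] X' → X ≈[ ws ] X'
≈-mono h (f , g) = (λ s xs → let (t , xt , a) = f s xs in t , xt , h a)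
                 , (λ t xt → let (s , xs , a) = g t xt in s , xs , h a)

≈-++ˡ : ∀ vs → X ≈[ vs ++ ws ] X' → X ≈[ vs ] X'
≈-++ˡ vs = ≈-mono (∼-++ˡ vs)

≈-++ʳ : ∀ vs → X ≈[ vs ++ ws ] X' → X ≈[ ws ] X'
≈-++ʳ vs = ≈-mono (∼-++ʳ vs)

≈-singleton : s ∼[ vs ] t → ⟦ s ⟧ ≈[ vs ] ⟦ t ⟧
≈-singleton {t = t} a = (λ { _ refl → t , refl , a }) , (λ { _ refl → _ , refl , a })

≈-NonEmpty : X ≈[ vs ] X' → NonEmpty X → NonEmpty X'
≈-NonEmpty (f , _) (s , xs) = let (t , xt , _) = f s xs in t , xt

≈-Empty : X ≈[ vs ] X' → Empty X → Empty X'
≈-Empty (_ , g) e t xt = let (s , xs , _) = g t xt in e s xs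

-- The split of X' keeps those t ∈ X' that agree on vs with some element of Y (resp. Z).
≈-split : X ≈[ vs ] X' → IsUnion X Y Z →
  Σ Team λ Y' → Σ Team λ Z' → IsUnion X' Y' Z' × Y ≈[ vs ] Y' × Z ≈[ vs ] Z'
≈-split {X} {vs} {X'} {Y} {Z} (f , g) U =
  part Y , part Z , U' , (lift-part inj₁ , λ _ → proj₂) , (lift-part inj₂ , λ _ → proj₂)
  where
  part : Team → Team
  part W t = X' t × ∃ λ s → W s × s ∼[ vs ] t

  U' : IsUnion X' (part Y) (part Z)
  U' t = (λ xt → let (s , xs , a) = g t xt in
                 ⊎-map (λ ys → xt , s , ys , a) (λ zs → xt , s , zs , a) (proj₁ (U s) xs))
       , [ proj₁ , proj₁ ]

  lift-part : ∀ {W} → (∀ {s} → W s → Y s ⊎ Z s) → ∀ s → W s → ∃ λ t → part W t × s ∼[ vs ] t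
  lift-part into s ws = let (t , xt , a) = f s (proj₂ (U s) (into ws)) in t , (xt , s , ws , a) , a

⊨-local : ∀ φ → X ≈[ vars φ ] X' → X ⊨ φ → X' ⊨ φ
⊨-local (var i) (_ , g) (lift h) = lift λ t xt →
  let (s , xs , a) = g t xt in trans (sym (a i (here refl))) (h s xs)
⊨-local (negvar i) (_ , g) (lift h) = lift λ t xt →
  let (s , xs , a) = g t xt in trans (sym (a i (here refl))) (h s xs)
⊨-local NE R (lift n) = lift (≈-NonEmpty R n)
⊨-local falsum R (lift e) = lift (≈-Empty R e)
⊨-local (indep is js) (f , g) (lift h) = lift λ t t' xt xt' →
  let (s , xs , a) = g t xt
      (s' , xs' , a') = g t' xt'
      (s'' , xs'' , e₁ , e₂) = h s s' xs xs'
      (t'' , xt'' , a'') = f s'' xs''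
  in t'' , xt'' , trans (sym (∼⇒at≡ is (∼-++ˡ _ a''))) (trans e₁ (∼⇒at≡ is (∼-++ˡ _ a)))
               , trans (sym (∼⇒at≡ js (∼-++ʳ _ a''))) (trans e₂ (∼⇒at≡ js (∼-++ʳ _ a')))
⊨-local (dep is j) (_ , g) (lift h) = lift λ t t' xt xt' eq →
  let (s , xs , a) = g t xt
      (s' , xs' , a') = g t' xt'
      j∈ = ∈-++⁺ʳ (toList is) (here refl)
      same-is = trans (∼⇒at≡ is (∼-++ˡ _ a)) (trans eq (sym (∼⇒at≡ is (∼-++ˡ _ a'))))
  in trans (sym (a j j∈)) (trans (h s s' xs xs' same-is) (a' j j∈))
⊨-local (incl is js) (f , g) (lift h) = lift λ t xt →
  let (s , xs , a) = g t xt
      (s' , xs' , e) = h s xs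
      (t' , xt' , a') = f s' xs'
  in t' , xt' , trans (sym (∼⇒at≡ is (∼-++ˡ _ a))) (trans e (∼⇒at≡ js (∼-++ʳ _ a')))
⊨-local (φ ∧ᶠ ψ) R (p , q) =
  ⊨-local φ (≈-++ˡ (vars φ) R) p , ⊨-local ψ (≈-++ʳ (vars φ) R) q
⊨-local (φ ⊗ ψ) R (Y , Z , U , p , q) =
  let (Y' , Z' , U' , RY , RZ) = ≈-split R U in
  Y' , Z' , U' , ⊨-local φ (≈-++ˡ (vars φ) RY) p , ⊨-local ψ (≈-++ʳ (vars φ) RZ) q
⊨-local (φ ⊛ ψ) R (inj₁ (lift e)) = inj₁ (lift (≈-Empty R e))
⊨-local (φ ⊛ ψ) R (inj₂ (Y , Z , U , lift ny , lift nz , p , q)) =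
  let (Y' , Z' , U' , RY , RZ) = ≈-split R U in
  inj₂ (Y' , Z' , U' , lift (≈-NonEmpty RY ny) , lift (≈-NonEmpty RZ nz)
       , ⊨-local φ (≈-++ˡ (vars φ) RY) p , ⊨-local ψ (≈-++ʳ (vars φ) RZ) q)
⊨-local (φ ∨ᶠ ψ) R (inj₁ p) = inj₁ (⊨-local φ (≈-++ˡ (vars φ) R) p)
⊨-local (φ ∨ᶠ ψ) R (inj₂ q) = inj₂ (⊨-local ψ (≈-++ʳ (vars φ) R) q)

∅ : Team
∅ _ = ⊥

Flat⇒∅ : Flat φ → ∅ ⊨ φ
Flat⇒∅ flat = proj₂ (flat ∅) λ _ ()

⊗-introˡ : ∅ ⊨ ψ → X ⊨ φ → X ⊨ (φ ⊗ ψ)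
⊗-introˡ {X = X} e p = X , ∅ , (λ _ → inj₁ , [ (λ x → x) , (λ ()) ]) , p , e

⊗-introʳ : ∅ ⊨ φ → X ⊨ ψ → X ⊨ (φ ⊗ ψ)
⊗-introʳ {X = X} e q = ∅ , X , (λ _ → inj₂ , [ (λ ()) , (λ x → x) ]) , e , q

⊗-pointwise : Flat φ → Flat ψ → X ⊨ (φ ⊗ ψ) → ∀ s → X s → (⟦ s ⟧ ⊨ φ) ⊎ (⟦ s ⟧ ⊨ ψ)
⊗-pointwise fφ fψ (Y , Z , U , p , q) s xs =
  ⊎-map (proj₁ (fφ Y) p s) (proj₁ (fψ Z) q s) (proj₁ (U s) xs)

⊗-singleton : Flat φ → Flat ψ → (⟦ s ⟧ ⊨ (φ ⊗ ψ)) ⟺ ((⟦ s ⟧ ⊨ φ) ⊎ (⟦ s ⟧ ⊨ ψ))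
⊗-singleton {s = s} fφ fψ =
  (λ h → ⊗-pointwise fφ fψ h s refl) , [ ⊗-introˡ (Flat⇒∅ fψ) , ⊗-introʳ (Flat⇒∅ fφ) ]

Flat-resp-≡ˢ : φ ≡ˢ ψ → Flat ψ → Flat φ
Flat-resp-≡ˢ e fψ X =
    (λ h s xs → proj₂ (e ⟦ s ⟧) (proj₁ (fψ X) (proj₁ (e X) h) s xs))
  , (λ h → proj₂ (e X) (proj₂ (fψ X) (λ s xs → proj₁ (e ⟦ s ⟧) (h s xs))))

flat-≡ˢ : Flat φ → Flat ψ → (∀ s → (⟦ s ⟧ ⊨ φ) ⟺ (⟦ s ⟧ ⊨ ψ)) → φ ≡ˢ ψ
flat-≡ˢ fφ fψ e X =
    (λ h → proj₂ (fψ X) (λ s xs → proj₁ (e s) (proj₁ (fφ X) h s xs)))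
  , (λ h → proj₂ (fφ X) (λ s xs → proj₂ (e s) (proj₁ (fψ X) h s xs)))

flat⇒downwardClosed : Flat φ → DownwardClosed φ
flat⇒downwardClosed flat X Y h Y⊆X = proj₂ (flat Y) (λ s ys → proj₁ (flat X) h s (Y⊆X s ys))

flat⇒unionClosed : Flat φ → UnionClosed φ
flat⇒unionClosed flat I F h = proj₂ (flat (⋃ F)) (λ { s (i , fs) → proj₁ (flat (F i)) (h i) s fs })

downwardClosed×unionClosed⇒flat : DownwardClosed φ × UnionClosed φ → Flat φ
downwardClosed×unionClosed⇒flat (dc , uc) X =
    (λ h s xs → dc X ⟦ s ⟧ h (λ { _ refl → xs }))
  , (λ h → dc (⋃ singletons) X (uc (Σ Valuation X) singletons (λ (s , xs) → h s xs))
                               (λ s xs → (s , xs) , refl))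
  where
  singletons : Σ Valuation X → Team
  singletons (s , _) = ⟦ s ⟧

literal : ℕ → Bool → Formula
literal i true  = var i
literal i false = negvar i

literal-classical : ∀ i b → Classical (literal i b)
literal-classical i true  = c-var i
literal-classical i false = c-negvar i

literal-singleton⁻ : ∀ i b → ⟦ s ⟧ ⊨ literal i b → s i ≡ b
literal-singleton⁻ i true  (lift h) = h _ refl
literal-singleton⁻ i false (lift h) = h _ refl

literal-singleton⁺ : ∀ i b → s i ≡ b → ⟦ s ⟧ ⊨ literal i b
literal-singleton⁺ i true  eq = lift λ { _ refl → eq }
literal-singleton⁺ i false eq = lift λ { _ refl → eq }

-- Classical formulas have no ⊤, but p₀ ⊗ ¬p₀ is valid.
verum : Formula
verum = var 0 ⊗ negvar 0

verum-classical : Classical verum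
verum-classical = c-⊗ (c-var 0) (c-negvar 0)

verum-singleton : ∀ s → ⟦ s ⟧ ⊨ verum
verum-singleton s with s 0 in eq
... | true  = ⊗-introˡ {ψ = negvar 0} {φ = var 0} (lift λ _ ()) (lift λ { _ refl → eq })
... | false = ⊗-introʳ {φ = var 0} {ψ = negvar 0} (lift λ _ ()) (lift λ { _ refl → eq })

_[_≔_] : Valuation → ℕ → Bool → Valuation
(s [ i ≔ b ]) j with j ≟ i
... | yes _ = b
... | no _  = s j

[≔]-cong : ∀ {i b} → s ∼[ vs ] t → (s [ i ≔ b ]) ∼[ i ∷ vs ] (t [ i ≔ b ])
[≔]-cong {i = i} a j j∈ with j ≟ i | j∈
... | yes _   | _         = refl
... | no j≢i  | here j≡i  = ⊥-elim (j≢i j≡i)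
... | no _    | there j∈′ = a j j∈′

[≔]-unchanged : ∀ {i b} → s i ≡ b → ∀ j → (s [ i ≔ b ]) j ≡ s j
[≔]-unchanged {i = i} eq j with j ≟ i
... | yes refl = sym eq
... | no _     = refl

Invariant : List ℕ → (Valuation → Set₁) → Set₁
Invariant vs P = ∀ {s t} → s ∼[ vs ] t → P s → P t

module _ (lem : ExcludedMiddle (suc zero)) where

  -- Satisfaction is Set₁-valued while teams are Set-valued; excluded middle turns
  -- a Set₁-predicate into a subteam.
  _∩_ : Team → (Valuation → Set₁) → Team
  (X ∩ P) s = X s × True (lem {P s})

  classical-flat : ∀ {φ} → Classical φ → Flat φ
  classical-flat (c-var i) X =
    (λ (lift h) s xs → lift λ { _ refl → h s xs }) , (λ h → lift λ s xs → lower (h s xs) s refl)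
  classical-flat (c-negvar i) X =
    (λ (lift h) s xs → lift λ { _ refl → h s xs }) , (λ h → lift λ s xs → lower (h s xs) s refl)
  classical-flat c-falsum X =
    (λ (lift e) s xs → ⊥-elim (e s xs)) , (λ h → lift λ s xs → lower (h s xs) s refl)
  classical-flat (c-∧ c d) X =
      (λ (p , q) s xs → proj₁ (classical-flat c X) p s xs , proj₁ (classical-flat d X) q s xs)
    , (λ h → proj₂ (classical-flat c X) (λ s xs → proj₁ (h s xs))
           , proj₂ (classical-flat d X) (λ s xs → proj₂ (h s xs)))
  classical-flat {φ ⊗ ψ} (c-⊗ c d) X =
    (λ h s xs → proj₂ (⊗-singleton fφ fψ) (⊗-pointwise fφ fψ h s xs)) , join
    where
    fφ = classical-flat c
    fψ = classical-flat d

    join : (∀ s → X s → ⟦ s ⟧ ⊨ (φ ⊗ ψ)) → X ⊨ (φ ⊗ ψ)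
    join h = Xφ , Xψ , cover , proj₂ (fφ Xφ) (λ _ → toWitness ∘ proj₂)
                           , proj₂ (fψ Xψ) (λ _ → toWitness ∘ proj₂)
      where
      Xφ Xψ : Team
      Xφ = X ∩ λ s → ⟦ s ⟧ ⊨ φ
      Xψ = X ∩ λ s → ⟦ s ⟧ ⊨ ψ
      cover : IsUnion X Xφ Xψ
      cover s = (λ xs → ⊎-map (λ p → xs , fromWitness p) (λ q → xs , fromWitness q)
                              (proj₁ (⊗-singleton fφ fψ) (h s xs)))
              , [ proj₁ , proj₁ ]

  -- A decision tree on the variables vs; a leaf is ⊤ or ⊥ according to P at an
  -- arbitrary valuation, which is faithful when P is invariant under vs.
  characteristic : List ℕ → (Valuation → Set₁) → Formula
  characteristic [] P with lem {P (λ _ → false)}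
  ... | yes _ = verum
  ... | no _  = falsum
  characteristic (i ∷ vs) P =
      (literal i true  ∧ᶠ characteristic vs (λ s → P (s [ i ≔ true ])))
    ⊗ (literal i false ∧ᶠ characteristic vs (λ s → P (s [ i ≔ false ])))

  characteristic-classical : ∀ vs P → Classical (characteristic vs P)
  characteristic-classical [] P with lem {P (λ _ → false)}
  ... | yes _ = verum-classical
  ... | no _  = c-falsum
  characteristic-classical (i ∷ vs) P =
    c-⊗ (c-∧ (literal-classical i true)  (characteristic-classical vs _))
        (c-∧ (literal-classical i false) (characteristic-classical vs _))

  characteristic-singleton : ∀ vs P → Invariant vs P → ∀ s → (⟦ s ⟧ ⊨ characteristic vs P) ⟺ P s
  characteristic-singleton [] P inv s with lem {P (λ _ → false)}
  ... | yes p  = (λ _ → inv (λ _ ()) p) , (λ _ → verum-singleton s)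
  ... | no ¬p  = (λ (lift e) → ⊥-elim (e s refl)) , (λ p → ⊥-elim (¬p (inv (λ _ ()) p)))
  characteristic-singleton (i ∷ vs) P inv s = into , out
    where
    branch : Bool → Formula
    branch b = literal i b ∧ᶠ characteristic vs (λ u → P (u [ i ≔ b ]))

    branch-flat : ∀ b → Flat (branch b)
    branch-flat b = classical-flat (c-∧ (literal-classical i b) (characteristic-classical vs _))

    split : (⟦ s ⟧ ⊨ characteristic (i ∷ vs) P) ⟺ ((⟦ s ⟧ ⊨ branch true) ⊎ (⟦ s ⟧ ⊨ branch false))
    split = ⊗-singleton {φ = branch true} {ψ = branch false} (branch-flat true) (branch-flat false)

    branch-singleton : ∀ b → (⟦ s ⟧ ⊨ branch b) ⟺ (s i ≡ b × P s)
    branch-singleton b =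
        (λ (l , c) → let eq = literal-singleton⁻ i b l in
                     eq , inv (λ j _ → [≔]-unchanged eq j) (proj₁ IH c))
      , (λ (eq , p) → literal-singleton⁺ i b eq
                    , proj₂ IH (inv (λ j _ → sym ([≔]-unchanged eq j)) p))
      where
      IH = characteristic-singleton vs _ (inv ∘ [≔]-cong) s

    into : ⟦ s ⟧ ⊨ characteristic (i ∷ vs) P → P s
    into = [ proj₂ ∘ proj₁ (branch-singleton true) , proj₂ ∘ proj₁ (branch-singleton false) ]
         ∘ proj₁ split

    out : P s → ⟦ s ⟧ ⊨ characteristic (i ∷ vs) P
    out p with s i in eq
    ... | true  = proj₂ split (inj₁ (proj₂ (branch-singleton true) (eq , p)))
    ... | false = proj₂ split (inj₂ (proj₂ (branch-singleton false) (eq , p)))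

  flat⇒equivClassical : ∀ φ → Flat φ → EquivClassical φ
  flat⇒equivClassical φ flat =
    characteristic (vars φ) P , classical ,
    flat-≡ˢ flat (classical-flat classical)
      (λ s → swap (characteristic-singleton (vars φ) P (⊨-local φ ∘ ≈-singleton) s))
    where
    P : Valuation → Set₁
    P s = ⟦ s ⟧ ⊨ φ
    classical = characteristic-classical (vars φ) P

  equivClassical⇒flat : EquivClassical φ → Flat φ
  equivClassical⇒flat (ψ , classical , φ≡ψ) = Flat-resp-≡ˢ φ≡ψ (classical-flat classical)

theorem3p2 : ExcludedMiddle (suc zero) → (φ : Formula) →
    (Flat φ ⟺ EquivClassical φ) × (Flat φ ⟺ (DownwardClosed φ × UnionClosed φ))
theorem3p2 lem φ =
    (flat⇒equivClassical lem φ , equivClassical⇒flat lem)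
  , ((λ flat → flat⇒downwardClosed flat , flat⇒unionClosed flat) , downwardClosed×unionClosed⇒flat)
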